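{- For every positive integer $n$, with $V_d(n)=\sum_{k=1}^n \frac{2^{2k}}{\binom{2k}{k}} k^d H_k$, we have \[ V_1(n) = \frac{(3n+1)(n+1)2^{2n+1}H_n}{15\binom{2n}{n}}-\frac{(18n^2-11n+1)2^{2n+1}}{225\binom{2n}{n}}+\frac{2}{225} \] and \[ V_2(n) = \frac{(n+1)(15n^2+12n-1)2^{2n+1}H_n}{105\binom{2n}{n}}-\frac{(450n^3-261n^2-328n+173)2^{2n+1}}{11025\binom{2n}{n}}+\frac{346}{11025}. \]
   Context: $H_k=\sum_{j=1}^k 1/j$ denotes the $k$-th harmonic number. -}

module Defs where

open import Data.Nat as ℕ using (ℕ; zero; suc; _≤_; _<_; z≤n; s≤s)
open import Data.Nat.Properties as ℕP using (m≤m+n; ≤-trans; <-≤-trans)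
open import Data.Nat.Combinatorics using (_C_; nCk+nC[k+1]≡[n+1]C[k+1]; nCn≡1)
open import Data.Integer as ℤ using (ℤ; +_)
open import Data.Rational as ℚ using (ℚ; _/_; _+_; _*_; 0ℚ; 1ℚ)
open import Relation.Binary.PropositionalEquality using (_≡_; refl; subst; sym)
open import Data.Sum using (inj₁; inj₂)

C-pos : ∀ n k → k ≤ n → 0 < n C k
C-pos n zero _ = s≤s z≤n
C-pos (suc n) (suc k) (s≤s k≤n) with ℕP.m≤n⇒m<n∨m≡n k≤n
... | inj₁ k<n = subst (0 <_) (nCk+nC[k+1]≡[n+1]C[k+1] n k)
                    (<-≤-trans (C-pos n k k≤n) (m≤m+n _ _))
... | inj₂ refl = subst (0 <_) (sym (nCn≡1 (suc k))) (s≤s z≤n)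

centralBinom : ℕ → ℕ
centralBinom n = (2 ℕ.* n) C n

centralBinom-nonZero : ∀ n → ℕ.NonZero (centralBinom n)
centralBinom-nonZero n = ℕ.>-nonZero (C-pos (2 ℕ.* n) n (ℕP.m≤n*m n 2))

_/[_·C2n,n_] : ℤ → (c : ℕ) → .{{ℕ.NonZero c}} → ℕ → ℚ
_/[_·C2n,n_] z c {{c≢0}} n = _/_ z (c ℕ.* centralBinom n)
  {{ℕP.m*n≢0 c (centralBinom n) {{c≢0}} {{centralBinom-nonZero n}}}}

ℕ→ℚ : ℕ → ℚ
ℕ→ℚ m = (+ m) / 1

H : ℕ → ℚ
H zero = 0ℚ
H (suc k) = H k + (+ 1) / suc k

a : ℕ → ℚ
a k = (+ (2 ℕ.^ (2 ℕ.* k))) /[ 1 ·C2n,n k ]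

V : ℕ → ℕ → ℚ
V d zero = 0ℚ
V d (suc n) = V d n + a (suc n) * ℕ→ℚ (suc n ℕ.^ d) * H (suc n)

-- Both identities telescope.  Put B n = 2^(2n+1) / binom(2n,n), so that the summand of V_d is
-- B k k^d H_k / 2 and both closed forms read p(n) B n H n - q(n) B n + c.  Since
-- B n = B(n+1) (2n+1)/(2n+2) and H(n+1) = H n + 1/(n+1), the increment of such a closed form is
-- the (n+1)-st summand as soon as two polynomial identities between p and q hold; for the
-- polynomials of the theorem these are checked by the ring solver.

module Submission where

open import Defs
open import Data.Nat as ℕ using (ℕ; zero; suc; NonZero; z≤n; s≤s)
import Data.Nat.Properties as ℕ
open import Data.Nat.Combinatorics using (_C_; nCk+nC[k+1]≡[n+1]C[k+1]; nCk≡nC[n∸k]; k>n⇒nCk≡0; nC1≡n)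
open import Data.Nat.Solver using (module +-*-Solver)
open import Data.Integer as ℤ using (ℤ; +_)
import Data.Integer.Properties as ℤ
import Data.Integer.Solver as ℤ
open import Data.Rational using (ℚ; _/_; _+_; _-_; _*_; -_; ½; 0ℚ; 1ℚ; toℚᵘ)
open import Data.Rational.Properties as ℚ
  using (toℚᵘ-injective; toℚᵘ-fromℚᵘ; toℚᵘ-homo-+; toℚᵘ-homo-*; toℚᵘ-homo‿-; /-cong; +-*-rawSemiring)
import Data.Rational.Solver as ℚ
open import Data.Rational.Unnormalised as ℚᵘ using (*≡*) renaming (_/_ to _/ᵘ_)
import Data.Rational.Unnormalised.Properties as ℚᵘ
-- the power the ring solver interprets _:^_ by, so that solver terms and goals agree definitionally
open import Algebra.Definitions.RawSemiring +-*-rawSemiring using (_^_)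
open import Data.Product using (_×_; _,_)
open import Relation.Binary.PropositionalEquality

[k+1]*[n+1]C[k+1]≡[n+1]*nCk : ∀ n k → suc k ℕ.* (suc n C suc k) ≡ suc n ℕ.* (n C k)
[k+1]*[n+1]C[k+1]≡[n+1]*nCk zero zero = refl
[k+1]*[n+1]C[k+1]≡[n+1]*nCk zero (suc k)
  rewrite k>n⇒nCk≡0 {1} {suc (suc k)} (s≤s (s≤s z≤n)) | k>n⇒nCk≡0 {0} {suc k} (s≤s z≤n)
  = ℕ.*-zeroʳ (suc (suc k))
[k+1]*[n+1]C[k+1]≡[n+1]*nCk (suc n) zero =
  trans (ℕ.*-identityˡ (suc (suc n) C 1)) (trans (nC1≡n (suc (suc n))) (sym (ℕ.*-identityʳ (suc (suc n)))))
[k+1]*[n+1]C[k+1]≡[n+1]*nCk (suc n) (suc k) = begin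
  suc (suc k) ℕ.* (suc (suc n) C suc (suc k))
    ≡⟨ cong (suc (suc k) ℕ.*_) (sym (nCk+nC[k+1]≡[n+1]C[k+1] (suc n) (suc k))) ⟩
  suc (suc k) ℕ.* (A ℕ.+ A′)
    ≡⟨ solve 3 (λ k A A′ → (con 2 :+ k) :* (A :+ A′) := A :+ (con 1 :+ k) :* A :+ (con 2 :+ k) :* A′) refl k A A′ ⟩
  A ℕ.+ suc k ℕ.* A ℕ.+ suc (suc k) ℕ.* A′
    ≡⟨ cong₂ (λ x y → A ℕ.+ x ℕ.+ y) ([k+1]*[n+1]C[k+1]≡[n+1]*nCk n k) ([k+1]*[n+1]C[k+1]≡[n+1]*nCk n (suc k)) ⟩
  A ℕ.+ suc n ℕ.* (n C k) ℕ.+ suc n ℕ.* (n C suc k)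
    ≡⟨ solve 4 (λ n A x y → A :+ (con 1 :+ n) :* x :+ (con 1 :+ n) :* y := A :+ (con 1 :+ n) :* (x :+ y)) refl n A (n C k) (n C suc k) ⟩
  A ℕ.+ suc n ℕ.* (n C k ℕ.+ n C suc k)
    ≡⟨ cong (λ x → A ℕ.+ suc n ℕ.* x) (nCk+nC[k+1]≡[n+1]C[k+1] n k) ⟩
  suc (suc n) ℕ.* A ∎
  where
  open ≡-Reasoning
  open +-*-Solver
  A A′ : ℕ
  A = suc n C suc k
  A′ = suc n C suc (suc k)

centralBinom-suc : ∀ n → suc n ℕ.* centralBinom (suc n) ≡ 2 ℕ.* (suc (2 ℕ.* n) ℕ.* centralBinom n)
centralBinom-suc n = begin
  suc n ℕ.* ((2 ℕ.* suc n) C suc n)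
    ≡⟨ cong (λ k → suc n ℕ.* (k C suc n)) (solve 1 (λ n → con 2 :* (con 1 :+ n) := con 2 :+ con 2 :* n) refl n) ⟩
  suc n ℕ.* (suc (suc m) C suc n)
    ≡⟨ cong (suc n ℕ.*_) (sym (nCk+nC[k+1]≡[n+1]C[k+1] (suc m) n)) ⟩
  suc n ℕ.* (suc m C n ℕ.+ A)
    ≡⟨ cong (λ x → suc n ℕ.* (x ℕ.+ A)) (trans (nCk≡nC[n∸k] n≤1+m) (cong (suc m C_) 1+m∸n≡1+n)) ⟩
  suc n ℕ.* (A ℕ.+ A)
    ≡⟨ solve 2 (λ n A → (con 1 :+ n) :* (A :+ A) := con 2 :* ((con 1 :+ n) :* A)) refl n A ⟩
  2 ℕ.* (suc n ℕ.* A)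
    ≡⟨ cong (2 ℕ.*_) ([k+1]*[n+1]C[k+1]≡[n+1]*nCk m n) ⟩
  2 ℕ.* (suc m ℕ.* (m C n)) ∎
  where
  open ≡-Reasoning
  open +-*-Solver
  m A : ℕ
  m = 2 ℕ.* n
  A = suc m C suc n
  n≤1+m : n ℕ.≤ suc m
  n≤1+m = ℕ.≤-trans (ℕ.m≤m+n n (n ℕ.+ 0)) (ℕ.n≤1+n m)
  1+m∸n≡1+n : suc m ℕ.∸ n ≡ suc n
  1+m∸n≡1+n = trans (cong (ℕ._∸ n) (solve 1 (λ n → con 1 :+ con 2 :* n := (con 1 :+ n) :+ n) refl n)) (ℕ.m+n∸n≡m (suc n) n)

ℤ→ℚ : ℤ → ℚ
ℤ→ℚ i = i / 1

toℚᵘ-/ : ∀ i m .{{_ : NonZero m}} → toℚᵘ (i / m) ℚᵘ.≃ i /ᵘ m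
toℚᵘ-/ i (suc m) = toℚᵘ-fromℚᵘ (i /ᵘ suc m)

/-*-/ : ∀ i j m k .{{_ : NonZero m}} .{{_ : NonZero k}} →
        i / m * (j / k) ≡ _/_ (i ℤ.* j) (m ℕ.* k) {{ℕ.m*n≢0 m k}}
/-*-/ i j m@(suc _) k@(suc _) = toℚᵘ-injective (ℚᵘ.≃-trans (toℚᵘ-homo-* (i / m) (j / k))
  (ℚᵘ.≃-trans (ℚᵘ.*-cong (toℚᵘ-/ i m) (toℚᵘ-/ j k)) (ℚᵘ.≃-sym (toℚᵘ-/ (i ℤ.* j) (m ℕ.* k)))))

/-cross : ∀ i j m k .{{_ : NonZero m}} .{{_ : NonZero k}} → i ℤ.* + k ≡ j ℤ.* + m → i / m ≡ j / k
/-cross i j m@(suc _) k@(suc _) eq =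
  toℚᵘ-injective (ℚᵘ.≃-trans (toℚᵘ-/ i m) (ℚᵘ.≃-trans (*≡* eq) (ℚᵘ.≃-sym (toℚᵘ-/ j k))))

+/-*-+/ : ∀ a b m k .{{_ : NonZero m}} .{{_ : NonZero k}} →
          (+ a) / m * ((+ b) / k) ≡ _/_ (+ (a ℕ.* b)) (m ℕ.* k) {{ℕ.m*n≢0 m k}}
+/-*-+/ a b m k = trans (/-*-/ (+ a) (+ b) m k) (/-cong {{ℕ.m*n≢0 m k}} {{ℕ.m*n≢0 m k}} (sym (ℤ.pos-* a b)) refl)

+/-cross : ∀ a b m k .{{_ : NonZero m}} .{{_ : NonZero k}} → a ℕ.* k ≡ b ℕ.* m → (+ a) / m ≡ (+ b) / k
+/-cross a b m k eq = /-cross (+ a) (+ b) m k (trans (sym (ℤ.pos-* a k)) (trans (cong +_ eq) (ℤ.pos-* b m)))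

/-as-* : ∀ i m .{{_ : NonZero m}} → i / m ≡ ℤ→ℚ i * ((+ 1) / m)
/-as-* i m = sym (trans (/-*-/ i (+ 1) 1 m) (/-cong {{ℕ.m*n≢0 1 m}} (ℤ.*-identityʳ i) (ℕ.*-identityˡ m)))

1/n*n≡1 : ∀ n .{{_ : NonZero n}} → (+ 1) / n * ℕ→ℚ n ≡ 1ℚ
1/n*n≡1 n = trans (+/-*-+/ 1 n n 1) (+/-cross (1 ℕ.* n) 1 (n ℕ.* 1) 1 {{ℕ.m*n≢0 n 1}} (ℕ.*-assoc 1 n 1))

ℤ→ℚ-* : ∀ i j → ℤ→ℚ (i ℤ.* j) ≡ ℤ→ℚ i * ℤ→ℚ j
ℤ→ℚ-* i j = sym (/-*-/ i j 1 1)

ℤ→ℚ-+ : ∀ i j → ℤ→ℚ (i ℤ.+ j) ≡ ℤ→ℚ i + ℤ→ℚ j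
ℤ→ℚ-+ i j = toℚᵘ-injective (ℚᵘ.≃-trans (toℚᵘ-/ (i ℤ.+ j) 1) (ℚᵘ.≃-trans (*≡* eq)
  (ℚᵘ.≃-sym (ℚᵘ.≃-trans (toℚᵘ-homo-+ (ℤ→ℚ i) (ℤ→ℚ j)) (ℚᵘ.+-cong (toℚᵘ-/ i 1) (toℚᵘ-/ j 1))))))
  where
  open ℤ.+-*-Solver
  eq : (i ℤ.+ j) ℤ.* + 1 ≡ (i ℤ.* + 1 ℤ.+ j ℤ.* + 1) ℤ.* + 1
  eq = solve 2 (λ i j → (i :+ j) :* con (+ 1) := (i :* con (+ 1) :+ j :* con (+ 1)) :* con (+ 1)) refl i j

ℤ→ℚ-neg : ∀ i → ℤ→ℚ (ℤ.- i) ≡ - ℤ→ℚ i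
ℤ→ℚ-neg i = toℚᵘ-injective (ℚᵘ.≃-trans (toℚᵘ-/ (ℤ.- i) 1)
  (ℚᵘ.≃-sym (ℚᵘ.≃-trans (toℚᵘ-homo‿- (ℤ→ℚ i)) (ℚᵘ.-‿cong (toℚᵘ-/ i 1)))))

ℤ→ℚ-- : ∀ i j → ℤ→ℚ (i ℤ.- j) ≡ ℤ→ℚ i - ℤ→ℚ j
ℤ→ℚ-- i j = trans (ℤ→ℚ-+ i (ℤ.- j)) (cong (λ x → ℤ→ℚ i + x) (ℤ→ℚ-neg j))

ℕ→ℚ-+ : ∀ m k → ℕ→ℚ (m ℕ.+ k) ≡ ℕ→ℚ m + ℕ→ℚ k
ℕ→ℚ-+ m k = trans (cong ℤ→ℚ (ℤ.pos-+ m k)) (ℤ→ℚ-+ (+ m) (+ k))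

ℕ→ℚ-* : ∀ m k → ℕ→ℚ (m ℕ.* k) ≡ ℕ→ℚ m * ℕ→ℚ k
ℕ→ℚ-* m k = trans (cong ℤ→ℚ (ℤ.pos-* m k)) (ℤ→ℚ-* (+ m) (+ k))

ℕ→ℚ-^ : ∀ m d → ℕ→ℚ (m ℕ.^ d) ≡ ℕ→ℚ m ^ d
ℕ→ℚ-^ m zero = refl
ℕ→ℚ-^ m (suc d) = trans (ℕ→ℚ-* m (m ℕ.^ d)) (cong (ℕ→ℚ m *_) (ℕ→ℚ-^ m d))

ℕ→ℚ-suc : ∀ n → ℕ→ℚ (suc n) ≡ ℕ→ℚ n + 1ℚ
ℕ→ℚ-suc n = trans (ℕ→ℚ-+ 1 n) (ℚ.+-comm 1ℚ (ℕ→ℚ n))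

B : ℕ → ℚ
B n = _/_ (+ (2 ℕ.^ (2 ℕ.* n ℕ.+ 1))) (centralBinom n) {{centralBinom-nonZero n}}

a≡B*½ : ∀ k → a k ≡ B k * ½
a≡B*½ k = sym (trans (+/-*-+/ (2 ℕ.^ (2 ℕ.* k ℕ.+ 1)) 1 c 2 {{centralBinom-nonZero k}}) (+/-cross (2 ℕ.^ (2 ℕ.* k ℕ.+ 1) ℕ.* 1) x (c ℕ.* 2) (1 ℕ.* c) {{ℕ.m*n≢0 c 2 {{centralBinom-nonZero k}}}} {{ℕ.m*n≢0 1 c {{_}} {{centralBinom-nonZero k}}}} eq))
  where
  open +-*-Solver
  x c : ℕ
  x = 2 ℕ.^ (2 ℕ.* k)
  c = centralBinom k
  eq : 2 ℕ.^ (2 ℕ.* k ℕ.+ 1) ℕ.* 1 ℕ.* (1 ℕ.* c) ≡ x ℕ.* (c ℕ.* 2)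
  eq rewrite ℕ.^-distribˡ-+-* 2 (2 ℕ.* k) 1 = solve 2 (λ x c → x :* con 2 :* con 1 :* (con 1 :* c) := x :* (c :* con 2)) refl x c

B-ratio : ∀ n → B n ≡ B (suc n) * ((+ suc (2 ℕ.* n)) / (2 ℕ.* suc n))
B-ratio n = sym (trans (+/-*-+/ W′ c (centralBinom (suc n)) (2 ℕ.* suc n) {{centralBinom-nonZero (suc n)}})
  (+/-cross (W′ ℕ.* c) W (centralBinom (suc n) ℕ.* (2 ℕ.* suc n)) (centralBinom n) {{ℕ.m*n≢0 (centralBinom (suc n)) (2 ℕ.* suc n) {{centralBinom-nonZero (suc n)}}}} {{centralBinom-nonZero n}} eq))
  where
  open +-*-Solver
  open ≡-Reasoning
  W W′ c : ℕ
  W = 2 ℕ.^ (2 ℕ.* n ℕ.+ 1)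
  W′ = 2 ℕ.^ (2 ℕ.* suc n ℕ.+ 1)
  c = suc (2 ℕ.* n)
  W′≡W*4 : W′ ≡ W ℕ.* 4
  W′≡W*4 = trans (cong (2 ℕ.^_) (solve 1 (λ n → con 2 :* (con 1 :+ n) :+ con 1 := (con 2 :* n :+ con 1) :+ con 2) refl n))
                 (ℕ.^-distribˡ-+-* 2 (2 ℕ.* n ℕ.+ 1) 2)
  eq : W′ ℕ.* c ℕ.* centralBinom n ≡ W ℕ.* (centralBinom (suc n) ℕ.* (2 ℕ.* suc n))
  eq = begin
    W′ ℕ.* c ℕ.* centralBinom n
      ≡⟨ cong (λ y → y ℕ.* c ℕ.* centralBinom n) W′≡W*4 ⟩
    W ℕ.* 4 ℕ.* c ℕ.* centralBinom n
      ≡⟨ solve 3 (λ W c b → W :* con 4 :* c :* b := W :* (con 2 :* (con 2 :* (c :* b)))) refl W c (centralBinom n) ⟩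
    W ℕ.* (2 ℕ.* (2 ℕ.* (c ℕ.* centralBinom n)))
      ≡⟨ cong (λ y → W ℕ.* (2 ℕ.* y)) (sym (centralBinom-suc n)) ⟩
    W ℕ.* (2 ℕ.* (suc n ℕ.* centralBinom (suc n)))
      ≡⟨ solve 3 (λ W n b → W :* (con 2 :* ((con 1 :+ n) :* b)) := W :* (b :* (con 2 :* (con 1 :+ n)))) refl W n (centralBinom (suc n)) ⟩
    W ℕ.* (centralBinom (suc n) ℕ.* (2 ℕ.* suc n)) ∎

[2n+1]/[2n+2]≡[n+½]/[n+1] : ∀ n → (+ suc (2 ℕ.* n)) / (2 ℕ.* suc n) ≡ (+ 1) / suc n * (ℕ→ℚ n + ½)
[2n+1]/[2n+2]≡[n+½]/[n+1] n = begin
  (+ suc (2 ℕ.* n)) / (2 ℕ.* suc n)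
    ≡⟨ /-as-* (+ suc (2 ℕ.* n)) (2 ℕ.* suc n) ⟩
  ℕ→ℚ (1 ℕ.+ 2 ℕ.* n) * ((+ 1) / (2 ℕ.* suc n))
    ≡⟨ cong₂ _*_ (trans (ℕ→ℚ-+ 1 (2 ℕ.* n)) (cong (λ x → 1ℚ + x) (ℕ→ℚ-* 2 n))) (sym (+/-*-+/ 1 1 2 (suc n))) ⟩
  (1ℚ + ℕ→ℚ 2 * ℕ→ℚ n) * (½ * ((+ 1) / suc n))
    ≡⟨ solve 2 (λ N s → (con 1ℚ :+ con (ℕ→ℚ 2) :* N) :* (con ½ :* s) := s :* (N :+ con ½)) refl (ℕ→ℚ n) ((+ 1) / suc n) ⟩
  (+ 1) / suc n * (ℕ→ℚ n + ½) ∎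
  where
  open ℚ.+-*-Solver
  open ≡-Reasoning

telescope-step : ∀ x t η P₀ P₁ Q₀ Q₁ W c →
  P₀ * (x + ½) + ½ * ((x + 1ℚ) * W) ≡ (x + 1ℚ) * P₁ →
  ½ * W - Q₀ * (x + ½) ≡ P₁ - (x + 1ℚ) * Q₁ →
  P₀ * (t * (x + ½)) * η - Q₀ * (t * (x + ½)) + c + ½ * W * (t * (x + 1ℚ) * η + t)
    ≡ P₁ * (t * (x + 1ℚ) * η + t) - Q₁ * (t * (x + 1ℚ)) + c
telescope-step x t η P₀ P₁ Q₀ Q₁ W c hp hq = begin
  P₀ * (t * (x + ½)) * η - Q₀ * (t * (x + ½)) + c + ½ * W * (t * (x + 1ℚ) * η + t)
    ≡⟨ solve 7 (λ x t η P₀ Q₀ W c →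
         P₀ :* (t :* (x :+ con ½)) :* η :- Q₀ :* (t :* (x :+ con ½)) :+ c :+ con ½ :* W :* (t :* (x :+ con 1ℚ) :* η :+ t)
         := t :* η :* (P₀ :* (x :+ con ½) :+ con ½ :* ((x :+ con 1ℚ) :* W)) :+ t :* (con ½ :* W :- Q₀ :* (x :+ con ½)) :+ c)
         refl x t η P₀ Q₀ W c ⟩
  t * η * (P₀ * (x + ½) + ½ * ((x + 1ℚ) * W)) + t * (½ * W - Q₀ * (x + ½)) + c
    ≡⟨ cong₂ (λ u v → t * η * u + t * v + c) hp hq ⟩
  t * η * ((x + 1ℚ) * P₁) + t * (P₁ - (x + 1ℚ) * Q₁) + c
    ≡⟨ solve 6 (λ x t η P₁ Q₁ c →
         t :* η :* ((x :+ con 1ℚ) :* P₁) :+ t :* (P₁ :- (x :+ con 1ℚ) :* Q₁) :+ c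
         := P₁ :* (t :* (x :+ con 1ℚ) :* η :+ t) :- Q₁ :* (t :* (x :+ con 1ℚ)) :+ c)
         refl x t η P₁ Q₁ c ⟩
  P₁ * (t * (x + 1ℚ) * η + t) - Q₁ * (t * (x + 1ℚ)) + c ∎
  where
  open ℚ.+-*-Solver
  open ≡-Reasoning

closedForm : (ℚ → ℚ) → (ℚ → ℚ) → ℚ → ℕ → ℚ
closedForm p q c n = p (ℕ→ℚ n) * B n * H n - q (ℕ→ℚ n) * B n + c

V≡closedForm : ∀ d (p q : ℚ → ℚ) c →
  (∀ x → p x * (x + ½) + ½ * (x + 1ℚ) ^ suc d ≡ (x + 1ℚ) * p (x + 1ℚ)) →
  (∀ x → ½ * (x + 1ℚ) ^ d - q x * (x + ½) ≡ p (x + 1ℚ) - (x + 1ℚ) * q (x + 1ℚ)) →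
  closedForm p q c 0 ≡ 0ℚ →
  ∀ n → V d n ≡ closedForm p q c n
V≡closedForm d p q c hp hq base zero = sym base
V≡closedForm d p q c hp hq base (suc n) = begin
  V d n + a (suc n) * ℕ→ℚ (suc n ℕ.^ d) * H (suc n)
    ≡⟨ cong₂ _+_ (V≡closedForm d p q c hp hq base n) summand ⟩
  p N * B n * η - q N * B n + c + ½ * X ^ d * (B′ * H (suc n))
    ≡⟨ cong₂ (λ β e → p N * β * η - q N * β + c + ½ * X ^ d * e) B-down BH-up ⟩
  p N * (t * (N + ½)) * η - q N * (t * (N + ½)) + c + ½ * X ^ d * (t * X * η + t)
    ≡⟨ cong (λ x → p N * (t * (N + ½)) * η - q N * (t * (N + ½)) + c + ½ * x ^ d * (t * x * η + t)) X≡N+1 ⟩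
  p N * (t * (N + ½)) * η - q N * (t * (N + ½)) + c + ½ * (N + 1ℚ) ^ d * (t * (N + 1ℚ) * η + t)
    ≡⟨ telescope-step N t η (p N) (p (N + 1ℚ)) (q N) (q (N + 1ℚ)) ((N + 1ℚ) ^ d) c (hp N) (hq N) ⟩
  p (N + 1ℚ) * (t * (N + 1ℚ) * η + t) - q (N + 1ℚ) * (t * (N + 1ℚ)) + c
    ≡⟨ cong (λ x → p x * (t * x * η + t) - q x * (t * x) + c) (sym X≡N+1) ⟩
  p X * (t * X * η + t) - q X * (t * X) + c
    ≡⟨ cong₂ (λ e β → p X * e - q X * β + c) (sym BH-up) (sym B-up) ⟩
  p X * (B′ * H (suc n)) - q X * B′ + c
    ≡⟨ cong (λ u → u - q X * B′ + c) (sym (ℚ.*-assoc (p X) B′ (H (suc n)))) ⟩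
  closedForm p q c (suc n) ∎
  where
  -- Through t = B(n+1)/(n+1), both B n and B(n+1) H(n+1) become polynomial in n, t and H n.
  open ≡-Reasoning
  N X η B′ t : ℚ
  N = ℕ→ℚ n
  X = ℕ→ℚ (suc n)
  η = H n
  B′ = B (suc n)
  t = B′ * ((+ 1) / suc n)

  X≡N+1 : X ≡ N + 1ℚ
  X≡N+1 = ℕ→ℚ-suc n

  summand : a (suc n) * ℕ→ℚ (suc n ℕ.^ d) * H (suc n) ≡ ½ * X ^ d * (B′ * H (suc n))
  summand = trans (cong₂ (λ u v → u * v * H (suc n)) (a≡B*½ (suc n)) (ℕ→ℚ-^ (suc n) d))
    (solve 3 (λ b w h → b :* con ½ :* w :* h := con ½ :* w :* (b :* h)) refl B′ (X ^ d) (H (suc n)))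
    where open ℚ.+-*-Solver

  B-down : B n ≡ t * (N + ½)
  B-down = trans (B-ratio n) (trans (cong (B′ *_) ([2n+1]/[2n+2]≡[n+½]/[n+1] n))
    (sym (ℚ.*-assoc B′ ((+ 1) / suc n) (N + ½))))

  B-up : B′ ≡ t * X
  B-up = sym (trans (ℚ.*-assoc B′ ((+ 1) / suc n) X)
    (trans (cong (B′ *_) (1/n*n≡1 (suc n))) (ℚ.*-identityʳ B′)))

  BH-up : B′ * H (suc n) ≡ t * X * η + t
  BH-up = trans (ℚ.*-distribˡ-+ B′ η ((+ 1) / suc n)) (cong (λ β → β * η + t) B-up)

infixl 6 _⊕_ _⊖_
infixl 7 _⊗_

data Poly : Set where
  var : Poly
  lit : ℤ → Poly
  _⊕_ _⊖_ _⊗_ : Poly → Poly → Poly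

⟦_⟧ℤ : Poly → ℤ → ℤ
⟦ var ⟧ℤ i = i
⟦ lit c ⟧ℤ i = c
⟦ e ⊕ f ⟧ℤ i = ⟦ e ⟧ℤ i ℤ.+ ⟦ f ⟧ℤ i
⟦ e ⊖ f ⟧ℤ i = ⟦ e ⟧ℤ i ℤ.- ⟦ f ⟧ℤ i
⟦ e ⊗ f ⟧ℤ i = ⟦ e ⟧ℤ i ℤ.* ⟦ f ⟧ℤ i

⟦_⟧ℚ : Poly → ℚ → ℚ
⟦ var ⟧ℚ x = x
⟦ lit c ⟧ℚ x = ℤ→ℚ c
⟦ e ⊕ f ⟧ℚ x = ⟦ e ⟧ℚ x + ⟦ f ⟧ℚ x
⟦ e ⊖ f ⟧ℚ x = ⟦ e ⟧ℚ x - ⟦ f ⟧ℚ x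
⟦ e ⊗ f ⟧ℚ x = ⟦ e ⟧ℚ x * ⟦ f ⟧ℚ x

ℤ→ℚ-⟦⟧ : ∀ e i → ℤ→ℚ (⟦ e ⟧ℤ i) ≡ ⟦ e ⟧ℚ (ℤ→ℚ i)
ℤ→ℚ-⟦⟧ var i = refl
ℤ→ℚ-⟦⟧ (lit c) i = refl
ℤ→ℚ-⟦⟧ (e ⊕ f) i = trans (ℤ→ℚ-+ (⟦ e ⟧ℤ i) (⟦ f ⟧ℤ i)) (cong₂ _+_ (ℤ→ℚ-⟦⟧ e i) (ℤ→ℚ-⟦⟧ f i))
ℤ→ℚ-⟦⟧ (e ⊖ f) i = trans (ℤ→ℚ-- (⟦ e ⟧ℤ i) (⟦ f ⟧ℤ i)) (cong₂ _-_ (ℤ→ℚ-⟦⟧ e i) (ℤ→ℚ-⟦⟧ f i))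
ℤ→ℚ-⟦⟧ (e ⊗ f) i = trans (ℤ→ℚ-* (⟦ e ⟧ℤ i) (⟦ f ⟧ℤ i)) (cong₂ _*_ (ℤ→ℚ-⟦⟧ e i) (ℤ→ℚ-⟦⟧ f i))

-- e read as a term of the ring solver, evaluating definitionally to ⟦ e ⟧ℚ
_⟨_⟩ : ∀ {k} → Poly → ℚ.+-*-Solver.Polynomial k → ℚ.+-*-Solver.Polynomial k
var ⟨ x ⟩ = x
lit c ⟨ x ⟩ = ℚ.+-*-Solver.con (ℤ→ℚ c)
(e ⊕ f) ⟨ x ⟩ = e ⟨ x ⟩ ℚ.+-*-Solver.:+ f ⟨ x ⟩
(e ⊖ f) ⟨ x ⟩ = e ⟨ x ⟩ ℚ.+-*-Solver.:- f ⟨ x ⟩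
(e ⊗ f) ⟨ x ⟩ = e ⟨ x ⟩ ℚ.+-*-Solver.:* f ⟨ x ⟩

poly-/[·C2n,n] : ∀ e c .{{_ : NonZero c}} n →
  (⟦ e ⟧ℤ (+ n) ℤ.* + (2 ℕ.^ (2 ℕ.* n ℕ.+ 1))) /[ c ·C2n,n n ] ≡ ⟦ e ⟧ℚ (ℕ→ℚ n) * ((+ 1) / c) * B n
poly-/[·C2n,n] e c n = trans (sym (/-*-/ (⟦ e ⟧ℤ (+ n)) _ c (centralBinom n) {{_}} {{centralBinom-nonZero n}}))
  (cong (_* B n) (trans (/-as-* (⟦ e ⟧ℤ (+ n)) c) (cong (_* ((+ 1) / c)) (ℤ→ℚ-⟦⟧ e (+ n)))))

closedForm-poly : ∀ P Q c₁ c₂ .{{_ : NonZero c₁}} .{{_ : NonZero c₂}} c n →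
  closedForm (λ x → ⟦ P ⟧ℚ x * ((+ 1) / c₁)) (λ x → ⟦ Q ⟧ℚ x * ((+ 1) / c₂)) c n
    ≡ (⟦ P ⟧ℤ (+ n) ℤ.* + (2 ℕ.^ (2 ℕ.* n ℕ.+ 1))) /[ c₁ ·C2n,n n ] * H n
      - (⟦ Q ⟧ℤ (+ n) ℤ.* + (2 ℕ.^ (2 ℕ.* n ℕ.+ 1))) /[ c₂ ·C2n,n n ] + c
closedForm-poly P Q c₁ c₂ c n =
  sym (cong₂ (λ u v → u * H n - v + c) (poly-/[·C2n,n] P c₁ n) (poly-/[·C2n,n] Q c₂ n))

P₁ Q₁ P₂ Q₂ : Poly
P₁ = (lit (+ 3) ⊗ var ⊕ lit (+ 1)) ⊗ (var ⊕ lit (+ 1))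
Q₁ = lit (+ 18) ⊗ var ⊗ var ⊖ lit (+ 11) ⊗ var ⊕ lit (+ 1)
P₂ = (var ⊕ lit (+ 1)) ⊗ (lit (+ 15) ⊗ var ⊗ var ⊕ lit (+ 12) ⊗ var ⊖ lit (+ 1))
Q₂ = lit (+ 450) ⊗ var ⊗ var ⊗ var ⊖ lit (+ 261) ⊗ var ⊗ var ⊖ lit (+ 328) ⊗ var ⊕ lit (+ 173)

p₁ q₁ p₂ q₂ : ℚ → ℚ
p₁ x = ⟦ P₁ ⟧ℚ x * ((+ 1) / 15)
q₁ x = ⟦ Q₁ ⟧ℚ x * ((+ 1) / 225)
p₂ x = ⟦ P₂ ⟧ℚ x * ((+ 1) / 105)
q₂ x = ⟦ Q₂ ⟧ℚ x * ((+ 1) / 11025)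

V₁≡closedForm : ∀ n → V 1 n ≡ closedForm p₁ q₁ ((+ 2) / 225) n
V₁≡closedForm = V≡closedForm 1 p₁ q₁ ((+ 2) / 225) hp hq refl
  where
  open ℚ.+-*-Solver
  p̂ q̂ : Polynomial 1 → Polynomial 1
  p̂ y = P₁ ⟨ y ⟩ :* con ((+ 1) / 15)
  q̂ y = Q₁ ⟨ y ⟩ :* con ((+ 1) / 225)
  hp : ∀ x → p₁ x * (x + ½) + ½ * (x + 1ℚ) ^ 2 ≡ (x + 1ℚ) * p₁ (x + 1ℚ)
  hp = solve 1 (λ x → p̂ x :* (x :+ con ½) :+ con ½ :* (x :+ con 1ℚ) :^ 2 := (x :+ con 1ℚ) :* p̂ (x :+ con 1ℚ)) refl
  hq : ∀ x → ½ * (x + 1ℚ) ^ 1 - q₁ x * (x + ½) ≡ p₁ (x + 1ℚ) - (x + 1ℚ) * q₁ (x + 1ℚ)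
  hq = solve 1 (λ x → con ½ :* (x :+ con 1ℚ) :^ 1 :- q̂ x :* (x :+ con ½) := p̂ (x :+ con 1ℚ) :- (x :+ con 1ℚ) :* q̂ (x :+ con 1ℚ)) refl

V₂≡closedForm : ∀ n → V 2 n ≡ closedForm p₂ q₂ ((+ 346) / 11025) n
V₂≡closedForm = V≡closedForm 2 p₂ q₂ ((+ 346) / 11025) hp hq refl
  where
  open ℚ.+-*-Solver
  p̂ q̂ : Polynomial 1 → Polynomial 1
  p̂ y = P₂ ⟨ y ⟩ :* con ((+ 1) / 105)
  q̂ y = Q₂ ⟨ y ⟩ :* con ((+ 1) / 11025)
  hp : ∀ x → p₂ x * (x + ½) + ½ * (x + 1ℚ) ^ 3 ≡ (x + 1ℚ) * p₂ (x + 1ℚ)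
  hp = solve 1 (λ x → p̂ x :* (x :+ con ½) :+ con ½ :* (x :+ con 1ℚ) :^ 3 := (x :+ con 1ℚ) :* p̂ (x :+ con 1ℚ)) refl
  hq : ∀ x → ½ * (x + 1ℚ) ^ 2 - q₂ x * (x + ½) ≡ p₂ (x + 1ℚ) - (x + 1ℚ) * q₂ (x + 1ℚ)
  hq = solve 1 (λ x → con ½ :* (x :+ con 1ℚ) :^ 2 :- q̂ x :* (x :+ con ½) := p̂ (x :+ con 1ℚ) :- (x :+ con 1ℚ) :* q̂ (x :+ con 1ℚ)) refl

corollary3p4 : (n : ℕ) → .{{_ : NonZero n}} →
  (V 1 n ≡
    ((+ 3 ℤ.* + n ℤ.+ + 1) ℤ.* (+ n ℤ.+ + 1) ℤ.* + (2 ℕ.^ (2 ℕ.* n ℕ.+ 1))) /[ 15 ·C2n,n n ] * H n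
    - ((+ 18 ℤ.* + n ℤ.* + n ℤ.- + 11 ℤ.* + n ℤ.+ + 1) ℤ.* + (2 ℕ.^ (2 ℕ.* n ℕ.+ 1))) /[ 225 ·C2n,n n ]
    + (+ 2) / 225)
  ×
  (V 2 n ≡
    ((+ n ℤ.+ + 1) ℤ.* (+ 15 ℤ.* + n ℤ.* + n ℤ.+ + 12 ℤ.* + n ℤ.- + 1) ℤ.* + (2 ℕ.^ (2 ℕ.* n ℕ.+ 1))) /[ 105 ·C2n,n n ] * H n
    - ((+ 450 ℤ.* + n ℤ.* + n ℤ.* + n ℤ.- + 261 ℤ.* + n ℤ.* + n ℤ.- + 328 ℤ.* + n ℤ.+ + 173) ℤ.* + (2 ℕ.^ (2 ℕ.* n ℕ.+ 1))) /[ 11025 ·C2n,n n ]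
    + (+ 346) / 11025)
corollary3p4 n =
    trans (V₁≡closedForm n) (closedForm-poly P₁ Q₁ 15 225 ((+ 2) / 225) n)
  , trans (V₂≡closedForm n) (closedForm-poly P₂ Q₂ 105 11025 ((+ 346) / 11025) n)
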